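{- For $n\geq 1$, $a_n(312;213) = 1$.
   Context: $\mathcal{S}_n$ is the set of permutations of $[n]=\{1,\dots,n\}$, written in one-line notation $\pi=\pi_1\pi_2\cdots\pi_n$ with $\pi_i=\pi(i)$. A permutation is cyclic if it consists of exactly one $n$-cycle. For a cyclic $\pi$, its standard cycle notation is $C(\pi)=(c_1,c_2,\dots,c_n)$ with $c_1=1$ and $c_i=\pi_{c_{i-1}}$ for $2\le i\le n$. A sequence of distinct integers $w_1\cdots w_m$ contains a pattern $\sigma\in\mathcal{S}_k$ if there are indices $i_1<\dots<i_k$ with $w_{i_1}\cdots w_{i_k}$ in the same relative order as $\sigma_1\cdots\sigma_k$; otherwise it avoids $\sigma$. For $\sigma,\tau\in\mathcal{S}_3$, $\mathcal{A}_n(\sigma;\tau)$ is the set of cyclic permutations $\pi\in\mathcal{S}_n$ whose one-line notation avoids $\sigma$ and whose cycle notation $C(\pi)$ (as the sequence $c_1c_2\cdots c_n$) avoids $\tau$; $a_n(\sigma;\tau)=|\mathcal{A}_n(\sigma;\tau)|$. -}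

module Defs where

open import Data.Nat using (ℕ; zero; suc)
open import Data.Fin using (Fin; zero; suc; toℕ; _<_)
open import Data.Fin.Permutation using (Permutation′; _⟨$⟩ʳ_)
open import Data.Product using (Σ; ∃; _×_; _,_)
open import Data.Vec using (Vec; []; _∷_; lookup)
open import Function.Definitions using (Injective)
open import Function.Bundles using (_⇔_)
open import Relation.Binary.PropositionalEquality using (_≡_)
open import Relation.Nullary using (¬_)

iter : ∀ {n} → Permutation′ n → ℕ → Fin n → Fin n
iter π zero    x = x
iter π (suc k) x = π ⟨$⟩ʳ (iter π k x)

-- Standard cycle notation C(π) = (c_1,…,c_n), c_1 = 1, c_i = π(c_{i-1}).
-- 0-based: element 1 of [n] is  zero : Fin (suc m), and position i (0-based)
-- holds π^i(1).
cycleSeq : ∀ {m} → Permutation′ (suc m) → Fin (suc m) → Fin (suc m)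
cycleSeq π i = iter π (toℕ i) zero

-- π is cyclic (a single n-cycle) iff the orbit of 1 consists of n distinct
-- elements, i.e. the sequence c_1 … c_n has no repetitions.
Cyclic : ∀ {m} → Permutation′ (suc m) → Set
Cyclic π = Injective _≡_ _≡_ (cycleSeq π)

oneLine : ∀ {n} → Permutation′ n → Fin n → Fin n
oneLine π i = π ⟨$⟩ʳ i

StrictlyIncreasing : ∀ {k m} → (Fin k → Fin m) → Set
StrictlyIncreasing f = ∀ a b → a < b → f a < f b

Contains : ∀ {k m n} → (Fin m → Fin n) → Vec (Fin k) k → Set
Contains {k} {m} w σ =
  Σ (Fin k → Fin m) λ ι → StrictlyIncreasing ι ×
    (∀ a b → (w (ι a) < w (ι b)) ⇔ (lookup σ a < lookup σ b))

Avoids : ∀ {k m n} → (Fin m → Fin n) → Vec (Fin k) k → Set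
Avoids w σ = ¬ Contains w σ

-- Patterns in S_3, written 0-based in one-line notation.
p312 : Vec (Fin 3) 3
p312 = suc (suc zero) ∷ zero ∷ suc zero ∷ []

p213 : Vec (Fin 3) 3
p213 = suc zero ∷ zero ∷ suc (suc zero) ∷ []

InA : ∀ {m} → Vec (Fin 3) 3 → Vec (Fin 3) 3 → Permutation′ (suc m) → Set
InA σ τ π = Cyclic π × Avoids (oneLine π) σ × Avoids (cycleSeq π) τ

-- |A_n(σ;τ)| = 1 : there is exactly one such permutation (permutations
-- compared extensionally by their one-line notation).
ExactlyOne : ∀ {m} → (Permutation′ (suc m) → Set) → Set
ExactlyOne {m} P =
  Σ (Permutation′ (suc m)) λ π → P π ×
    (∀ ρ → P ρ → ∀ i → ρ ⟨$⟩ʳ i ≡ π ⟨$⟩ʳ i)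

module Submission where

open import Defs

open import Data.Nat as ℕ using (ℕ; zero; suc; z≤n; s≤s)
import Data.Nat.Properties as ℕ
open import Data.Fin using (Fin; zero; suc; toℕ; fromℕ; fromℕ<; inject₁; inject≤; lower₁; punchOut; _<_; _≤_)
open import Data.Fin.Properties
  using (toℕ-injective; toℕ<n; toℕ≤n; toℕ≤pred[n]; toℕ-fromℕ; toℕ-fromℕ<; toℕ-inject≤;
         toℕ-lower₁; inject₁-lower₁; lower₁-inject₁′; toℕ-inject₁-≢; ≤fromℕ; ≤∧≢⇒<;
         <-cmp; <-trans; <-irrefl; <-asym; ≤-antisym; _≟_; any?; injective⇒≤; injective⇒existsPivot; punchOut-injective; inject≤-injective)
open import Data.Fin.Permutation using (Permutation′; _⟨$⟩ʳ_; _⟨$⟩ˡ_; permutation; inverseʳ)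
open import Data.Product using (∃; _×_; _,_; proj₁; proj₂)
open import Data.Sum using (inj₁; inj₂)
open import Data.Vec using (Vec; _∷_; []; lookup)
open import Data.Empty using (⊥-elim)
open import Function.Base using (_∘_)
open import Function.Bundles using (_⇔_; mk⇔; Equivalence; Injection)
open import Function.Definitions using (Injective)
open import Function.Properties.Inverse using (↔⇒↣)
open import Relation.Binary.Definitions using (tri<; tri≈; tri>)
open import Relation.Binary.PropositionalEquality using (_≡_; _≢_; refl; sym; trans; cong; subst; subst₂; module ≡-Reasoning)
open import Relation.Nullary using (yes; no)

-- In a cyclic permutation avoiding 312 the last entry x = π(n) must be 1: by 312-avoidance every
-- value below x sits at a position before every value above x, so {1, …, x − 1} is π-invariant,
-- which a single n-cycle forbids unless it is empty. Hence n is the last letter of C(π), and a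
-- 213-avoiding sequence ending in its maximum is increasing; so C(π) = (1, 2, …, n) and
-- π = 2 3 ⋯ n 1, which does lie in A_n(312;213).

triple : ∀ {a} {A : Set a} → A → A → A → Fin 3 → A
triple x y z i = lookup (x ∷ y ∷ z ∷ []) i

triple-increasing : ∀ {n} {x y z : Fin n} → x < y → y < z → StrictlyIncreasing (triple x y z)
triple-increasing x<y y<z zero             (suc zero)       _ = x<y
triple-increasing x<y y<z zero             (suc (suc zero)) _ = <-trans x<y y<z
triple-increasing x<y y<z (suc zero)       (suc (suc zero)) _ = y<z
triple-increasing _   _   _                zero             ()
triple-increasing _   _   (suc zero)       (suc zero)       (s≤s ())
triple-increasing _   _   (suc (suc zero)) (suc zero)       (s≤s ())
triple-increasing _   _   (suc (suc zero)) (suc (suc zero)) (s≤s (s≤s ()))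

strictlyIncreasing-cancel-< : ∀ {k n} {h : Fin k → Fin n} → StrictlyIncreasing h →
                              ∀ {a b} → h a < h b → a < b
strictlyIncreasing-cancel-< h↑ {a} {b} ha<hb with <-cmp a b
... | tri< a<b _ _ = a<b
... | tri≈ _ refl _ = ⊥-elim (<-irrefl refl ha<hb)
... | tri> _ _ b<a = ⊥-elim (<-asym ha<hb (h↑ b a b<a))

strictlyIncreasing-injective : ∀ {k n} {f : Fin k → Fin n} → StrictlyIncreasing f → Injective _≡_ _≡_ f
strictlyIncreasing-injective f↑ {a} {b} fa≡fb with <-cmp a b
... | tri< a<b _ _ = ⊥-elim (<-irrefl fa≡fb (f↑ a b a<b))
... | tri≈ _ a≡b _ = a≡b
... | tri> _ _ b<a = ⊥-elim (<-irrefl (sym fa≡fb) (f↑ b a b<a))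

strictlyIncreasing-mono-≤ : ∀ {k n} {f : Fin k → Fin n} → StrictlyIncreasing f → ∀ {i j} → i ≤ j → f i ≤ f j
strictlyIncreasing-mono-≤ {f = f} f↑ {i} {j} i≤j with ℕ.m≤n⇒m<n∨m≡n i≤j
... | inj₁ i<j = ℕ.<⇒≤ (f↑ i j i<j)
... | inj₂ i≡j = ℕ.≤-reflexive (cong (λ x → toℕ (f x)) (toℕ-injective i≡j))

contains-by-relabelling : ∀ {k m n} (w : Fin m → Fin n) (σ : Vec (Fin k) k)
                          {ι : Fin k → Fin m} {h : Fin k → Fin n} →
                          StrictlyIncreasing ι → StrictlyIncreasing h →
                          (∀ a → w (ι a) ≡ h (lookup σ a)) → Contains w σ
contains-by-relabelling w σ {ι} ι↑ h↑ w∘ι≡h∘σ = ι , ι↑ , λ a b →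
  subst₂ (λ u v → (u < v) ⇔ (lookup σ a < lookup σ b)) (sym (w∘ι≡h∘σ a)) (sym (w∘ι≡h∘σ b))
    (mk⇔ (strictlyIncreasing-cancel-< h↑) (h↑ _ _))

contains-312 : ∀ {m n} (w : Fin m → Fin n) {p q r : Fin m} → p < q → q < r →
               w q < w r → w r < w p → Contains w p312
contains-312 w p<q q<r wq<wr wr<wp =
  contains-by-relabelling w p312 (triple-increasing p<q q<r) (triple-increasing wq<wr wr<wp)
    λ { zero → refl ; (suc zero) → refl ; (suc (suc zero)) → refl }

contains-213 : ∀ {m n} (w : Fin m → Fin n) {p q r : Fin m} → p < q → q < r →
               w q < w p → w p < w r → Contains w p213
contains-213 w p<q q<r wq<wp wp<wr =
  contains-by-relabelling w p213 (triple-increasing p<q q<r) (triple-increasing wq<wp wp<wr)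
    λ { zero → refl ; (suc zero) → refl ; (suc (suc zero)) → refl }

increasing-contains⇒increasing : ∀ {k m n} {w : Fin m → Fin n} {σ : Vec (Fin k) k} →
                                 StrictlyIncreasing w → Contains w σ → StrictlyIncreasing (lookup σ)
increasing-contains⇒increasing w↑ (ι , ι↑ , iso) a b a<b =
  Equivalence.to (iso a b) (w↑ (ι a) (ι b) (ι↑ a b a<b))

injective-bounded⇒≤ : ∀ {a n b} (f : Fin a → Fin n) → Injective _≡_ _≡_ f →
                      (∀ i → toℕ (f i) ℕ.< b) → a ℕ.≤ b
injective-bounded⇒≤ f f-injective f<b = injective⇒≤ {f = λ i → fromℕ< (f<b i)} λ {i} {j} eq →
  f-injective (toℕ-injective (trans (sym (toℕ-fromℕ< (f<b i))) (trans (cong toℕ eq) (toℕ-fromℕ< (f<b j)))))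

injective⇒surjective : ∀ {n} {f : Fin n → Fin n} → Injective _≡_ _≡_ f → ∀ y → ∃ λ i → f i ≡ y
injective⇒surjective {suc n} {f} f-injective y with any? (λ i → f i ≟ y)
... | yes hit  = hit
... | no  miss = ⊥-elim (ℕ.1+n≰n (injective⇒≤ {f = punchedOut} punchedOut-injective))
  where
  punchedOut : Fin (suc n) → Fin n
  punchedOut i = punchOut {i = y} (λ y≡fi → miss (i , sym y≡fi))
  punchedOut-injective : Injective _≡_ _≡_ punchedOut
  punchedOut-injective eq = f-injective (punchOut-injective {i = y} _ _ eq)

preimages-below⇒≤ : ∀ {n k b c} (f : Fin n → Fin k) → b ℕ.≤ k →
                    (∀ y → toℕ y ℕ.< b → ∃ λ x → f x ≡ y × toℕ x ℕ.< c) → b ℕ.≤ c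
preimages-below⇒≤ f b≤k preimage = injective-bounded⇒≤ (proj₁ ∘ pre) pre-injective (proj₂ ∘ proj₂ ∘ pre)
  where
  pre : ∀ y → ∃ λ x → f x ≡ inject≤ y b≤k × toℕ x ℕ.< _
  pre y = preimage (inject≤ y b≤k) (subst (ℕ._< _) (sym (toℕ-inject≤ y b≤k)) (toℕ<n y))
  pre-injective : Injective _≡_ _≡_ (proj₁ ∘ pre)
  pre-injective {y} {z} eq = inject≤-injective _ _ y z
    (trans (sym (proj₁ (proj₂ (pre y)))) (trans (cong f eq) (proj₁ (proj₂ (pre z)))))

-- If i < f i, the i + 1 values ≤ i would all have preimages below i; the pivot of an injection gives i ≤ f i.
strictlyIncreasing⇒≡id : ∀ {n} {f : Fin n → Fin n} → StrictlyIncreasing f → ∀ i → f i ≡ i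
strictlyIncreasing⇒≡id {f = f} f↑ i = ≤-antisym below above
  where
  f-injective : Injective _≡_ _≡_ f
  f-injective = strictlyIncreasing-injective f↑
  above : i ≤ f i
  above with j , j≤i , i≤fj ← injective⇒existsPivot f-injective i =
    ℕ.≤-trans i≤fj (strictlyIncreasing-mono-≤ f↑ j≤i)
  below : f i ≤ i
  below = ℕ.≮⇒≥ λ i<fi → ℕ.1+n≰n (preimages-below⇒≤ f (toℕ<n i) λ y y≤i →
    let x , fx≡y = injective⇒surjective f-injective y
    in x , fx≡y , strictlyIncreasing-cancel-< f↑ (subst (_< f i) (sym fx≡y) (ℕ.<-≤-trans y≤i i<fi)))

permutation-injective : ∀ {n} (π : Permutation′ n) → Injective _≡_ _≡_ (π ⟨$⟩ʳ_)
permutation-injective π = Injection.injective (↔⇒↣ π)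

orbit : ∀ {m} → Permutation′ (suc m) → ℕ → Fin (suc m)
orbit π k = iter π k zero

≡fromℕ : ∀ {m} {i : Fin (suc m)} → m ≡ toℕ i → i ≡ fromℕ m
≡fromℕ {m} m≡i = toℕ-injective (trans (sym m≡i) (sym (toℕ-fromℕ m)))

sucMod : ∀ {m} → Fin (suc m) → Fin (suc m)
sucMod {m} i with m ℕ.≟ toℕ i
... | yes _   = zero
... | no  m≢i = suc (lower₁ i m≢i)

predMod : ∀ {m} → Fin (suc m) → Fin (suc m)
predMod zero    = fromℕ _
predMod (suc i) = inject₁ i

sucMod-fromℕ : ∀ m → sucMod (fromℕ m) ≡ zero
sucMod-fromℕ m with m ℕ.≟ toℕ (fromℕ m)
... | yes _   = refl
... | no  m≢m = ⊥-elim (m≢m (sym (toℕ-fromℕ m)))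

toℕ-sucMod : ∀ {m} (i : Fin (suc m)) → m ≢ toℕ i → toℕ (sucMod i) ≡ suc (toℕ i)
toℕ-sucMod {m} i m≢i with m ℕ.≟ toℕ i
... | yes m≡i  = ⊥-elim (m≢i m≡i)
... | no  m≢i′ = cong suc (toℕ-lower₁ i m≢i′)

sucMod-predMod : ∀ {m} (i : Fin (suc m)) → sucMod (predMod i) ≡ i
sucMod-predMod {m} zero    = sucMod-fromℕ m
sucMod-predMod {m} (suc i) with m ℕ.≟ toℕ (inject₁ i)
... | yes m≡i = ⊥-elim (toℕ-inject₁-≢ i m≡i)
... | no  m≢i = cong suc (lower₁-inject₁′ i m≢i)

predMod-sucMod : ∀ {m} (i : Fin (suc m)) → predMod (sucMod i) ≡ i
predMod-sucMod {m} i with m ℕ.≟ toℕ i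
... | yes m≡i = sym (≡fromℕ m≡i)
... | no  m≢i = inject₁-lower₁ i m≢i

rotation : ∀ {m} → Permutation′ (suc m)
rotation = permutation sucMod predMod sucMod-predMod predMod-sucMod

toℕ-orbit-rotation : ∀ {m} k → k ℕ.≤ m → toℕ (orbit (rotation {m}) k) ≡ k
toℕ-orbit-rotation zero    _   = refl
toℕ-orbit-rotation (suc k) k<m =
  trans (toℕ-sucMod (orbit rotation k) (λ m≡k → ℕ.<⇒≢ k<m (trans (sym ih) (sym m≡k)))) (cong suc ih)
  where ih = toℕ-orbit-rotation k (ℕ.<⇒≤ k<m)

cycleSeq-rotation : ∀ {m} (i : Fin (suc m)) → cycleSeq rotation i ≡ i
cycleSeq-rotation i = toℕ-injective (toℕ-orbit-rotation (toℕ i) (toℕ≤pred[n] i))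

rotation-cyclic : ∀ {m} → Cyclic (rotation {m})
rotation-cyclic {_} {i} {j} eq = trans (sym (cycleSeq-rotation i)) (trans eq (cycleSeq-rotation j))

cycleSeq-rotation-increasing : ∀ {m} → StrictlyIncreasing (cycleSeq (rotation {m}))
cycleSeq-rotation-increasing a b a<b = subst₂ _<_ (sym (cycleSeq-rotation a)) (sym (cycleSeq-rotation b)) a<b

-- The only descent of 2 3 ⋯ n 1 ends at the last position, while in 312 the descent 3,1 is followed by 2.
rotation-avoids-312 : ∀ {m} → Avoids (oneLine (rotation {m})) p312
rotation-avoids-312 {m} (ι , ι↑ , iso) = <-asym descent ascent
  where
  descent : sucMod (ι (suc zero)) < sucMod (ι zero)
  descent = Equivalence.from (iso (suc zero) zero) (s≤s z≤n)
  second<m : toℕ (ι (suc zero)) ℕ.< m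
  second<m = ℕ.<-≤-trans (ι↑ (suc zero) (suc (suc zero)) (s≤s (s≤s z≤n))) (toℕ≤pred[n] (ι (suc (suc zero))))
  first<m : toℕ (ι zero) ℕ.< m
  first<m = ℕ.<-trans (ι↑ zero (suc zero) (s≤s z≤n)) second<m
  ascent : sucMod (ι zero) < sucMod (ι (suc zero))
  ascent = subst₂ ℕ._<_ (sym (toℕ-sucMod _ (ℕ.>⇒≢ first<m))) (sym (toℕ-sucMod _ (ℕ.>⇒≢ second<m)))
             (s≤s (ι↑ zero (suc zero) (s≤s z≤n)))

rotation-avoids-213 : ∀ {m} → Avoids (cycleSeq (rotation {m})) p213
rotation-avoids-213 contains
  with increasing-contains⇒increasing {σ = p213} cycleSeq-rotation-increasing contains zero (suc zero) (s≤s z≤n)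
... | ()

cycleSeq-sucMod : ∀ {m} (π : Permutation′ (suc m)) {i} → m ≢ toℕ i → cycleSeq π (sucMod i) ≡ π ⟨$⟩ʳ cycleSeq π i
cycleSeq-sucMod π {i} m≢i = cong (orbit π) (toℕ-sucMod i m≢i)

InvariantBelow : ∀ {n} → Permutation′ n → Fin n → Set
InvariantBelow π x = ∀ p → p < x → π ⟨$⟩ʳ p < x

cyclic-invariantBelow⇒zero : ∀ {m} {π : Permutation′ (suc m)} {x} → Cyclic π → InvariantBelow π x → x ≡ zero
cyclic-invariantBelow⇒zero {x = zero} _ _ = refl
cyclic-invariantBelow⇒zero {π = π} {x = suc x} cyclic invariant =
  ⊥-elim (ℕ.<⇒≱ (toℕ<n (suc x)) (injective-bounded⇒≤ (cycleSeq π) cyclic λ i → orbit-below (toℕ i)))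
  where
  orbit-below : ∀ k → orbit π k < suc x
  orbit-below zero    = s≤s z≤n
  orbit-below (suc k) = invariant _ (orbit-below k)

-- Otherwise p < q < n, with values above, below and equal to x = ρ n, would form a 312.
avoids-312⇒small-before-large : ∀ {m} {ρ : Permutation′ (suc m)} → Avoids (oneLine ρ) p312 →
                                ∀ {p q} → ρ ⟨$⟩ʳ q < ρ ⟨$⟩ʳ fromℕ m → ρ ⟨$⟩ʳ fromℕ m < ρ ⟨$⟩ʳ p → q < p
avoids-312⇒small-before-large {m} {ρ} avoids {p} {q} ρq<x x<ρp with <-cmp q p
... | tri< q<p _ _ = q<p
... | tri≈ _ refl _ = ⊥-elim (<-asym ρq<x x<ρp)
... | tri> _ _ p<q with q ≟ fromℕ m
...   | yes refl     = ⊥-elim (<-irrefl refl ρq<x)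
...   | no  q≢last = ⊥-elim (avoids (contains-312 (oneLine ρ) p<q (≤∧≢⇒< (≤fromℕ q) q≢last) ρq<x x<ρp))

-- If some p < x had ρ p > x, the x preimages of the values below x would all lie below p.
avoids-312⇒invariantBelow-last : ∀ {m} {ρ : Permutation′ (suc m)} → Avoids (oneLine ρ) p312 →
                                 InvariantBelow ρ (ρ ⟨$⟩ʳ fromℕ m)
avoids-312⇒invariantBelow-last {m} {ρ} avoids p p<x with <-cmp (ρ ⟨$⟩ʳ p) (ρ ⟨$⟩ʳ fromℕ m)
... | tri< ρp<x _ _ = ρp<x
... | tri≈ _ ρp≡x _ =
  ⊥-elim (ℕ.<⇒≱ p<x (subst (ρ ⟨$⟩ʳ fromℕ m ≤_) (sym (permutation-injective ρ ρp≡x)) (≤fromℕ _)))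
... | tri> _ _ x<ρp = ⊥-elim (ℕ.<⇒≱ p<x (preimages-below⇒≤ (ρ ⟨$⟩ʳ_) (toℕ≤n _) λ y y<x →
  ρ ⟨$⟩ˡ y , inverseʳ ρ ,
  avoids-312⇒small-before-large {ρ = ρ} avoids (subst (_< _) (sym (inverseʳ ρ)) y<x) x<ρp))

cyclic-last↦zero⇒cycleSeq-last : ∀ {m} {ρ : Permutation′ (suc m)} → Cyclic ρ → ρ ⟨$⟩ʳ fromℕ m ≡ zero →
                                  cycleSeq ρ (fromℕ m) ≡ fromℕ m
cyclic-last↦zero⇒cycleSeq-last {m} {ρ} cyclic last↦zero with injective⇒surjective cyclic (fromℕ m)
... | i , cycleSeq-i≡last with m ℕ.≟ toℕ i
...   | yes m≡i = subst (λ j → cycleSeq ρ j ≡ fromℕ m) (≡fromℕ m≡i) cycleSeq-i≡last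
...   | no  m≢i = ⊥-elim (ℕ.1+n≢0 (trans (sym (toℕ-sucMod i m≢i)) (cong toℕ (cyclic (begin
  cycleSeq ρ (sucMod i)     ≡⟨ cycleSeq-sucMod ρ m≢i ⟩
  ρ ⟨$⟩ʳ cycleSeq ρ i      ≡⟨ cong (ρ ⟨$⟩ʳ_) cycleSeq-i≡last ⟩
  ρ ⟨$⟩ʳ fromℕ m           ≡⟨ last↦zero ⟩
  zero                      ∎)))))
  where open ≡-Reasoning

avoids-213⇒increasing : ∀ {m n} {w : Fin (suc m) → Fin n} → Injective _≡_ _≡_ w → Avoids w p213 →
                        (∀ i → w i ≤ w (fromℕ m)) → StrictlyIncreasing w
avoids-213⇒increasing {m} {w = w} w-injective avoids w≤w-last a b a<b with <-cmp (w a) (w b)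
... | tri< wa<wb _ _ = wa<wb
... | tri≈ _ wa≡wb _ = ⊥-elim (<-irrefl (w-injective wa≡wb) a<b)
... | tri> _ _ wb<wa with b ≟ fromℕ m
...   | yes refl     = ⊥-elim (ℕ.<⇒≱ wb<wa (w≤w-last a))
...   | no  b≢last = ⊥-elim (avoids (contains-213 w a<b (≤∧≢⇒< (≤fromℕ b) b≢last) wb<wa wa<w-last))
  where
  wa<w-last : w a < w (fromℕ m)
  wa<w-last = ≤∧≢⇒< (w≤w-last a) λ wa≡w-last →
    ℕ.<⇒≱ a<b (subst (b ≤_) (sym (w-injective wa≡w-last)) (≤fromℕ b))

module Uniqueness {m} {ρ : Permutation′ (suc m)} (cyclic : Cyclic ρ)
                  (avoids-312 : Avoids (oneLine ρ) p312) (avoids-213 : Avoids (cycleSeq ρ) p213) where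

  last↦zero : ρ ⟨$⟩ʳ fromℕ m ≡ zero
  last↦zero = cyclic-invariantBelow⇒zero cyclic (avoids-312⇒invariantBelow-last {ρ = ρ} avoids-312)

  cycleSeq≡id : ∀ i → cycleSeq ρ i ≡ i
  cycleSeq≡id = strictlyIncreasing⇒≡id (avoids-213⇒increasing cyclic avoids-213 λ i →
    subst (cycleSeq ρ i ≤_) (sym (cyclic-last↦zero⇒cycleSeq-last cyclic last↦zero)) (≤fromℕ _))

  ≗rotation : ∀ i → ρ ⟨$⟩ʳ i ≡ rotation ⟨$⟩ʳ i
  ≗rotation i with i ≟ fromℕ m
  ... | yes refl   = trans last↦zero (sym (sucMod-fromℕ m))
  ... | no  i≢last = begin
    ρ ⟨$⟩ʳ i              ≡⟨ cong (ρ ⟨$⟩ʳ_) (cycleSeq≡id i) ⟨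
    ρ ⟨$⟩ʳ cycleSeq ρ i  ≡⟨ cycleSeq-sucMod ρ (i≢last ∘ ≡fromℕ) ⟨
    cycleSeq ρ (sucMod i) ≡⟨ cycleSeq≡id (sucMod i) ⟩
    sucMod i              ∎
    where open ≡-Reasoning

theorem3p22 : (m : ℕ) → ExactlyOne {m} (InA p312 p213)
theorem3p22 m = rotation , (rotation-cyclic , rotation-avoids-312 , rotation-avoids-213) ,
  λ ρ (cyclic , avoids-312 , avoids-213) → Uniqueness.≗rotation cyclic avoids-312 avoids-213
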